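{- For every integer $n\ge 7$, $\sigma_d\mathrm{mex}(n+1)>\sigma_d\mathrm{mex}(n)$.
   Context: For a partition $\pi$, $\mathrm{mex}(\pi)$ is the least positive integer that is not a part of $\pi$. Let $\mathcal{D}(n)$ be the set of partitions of $n$ into distinct parts, and $\sigma_d\mathrm{mex}(n) := \sum_{\pi\in\mathcal{D}(n)} \mathrm{mex}(\pi)$. -}

module Defs where

open import Data.Nat using (ℕ; zero; suc; _+_; _∸_; _≤?_; _≟_)
open import Data.List using (List; []; _∷_; _++_; map)
open import Data.Nat.ListAction using (sum)
open import Data.Bool.ListAction using (any)
open import Relation.Nullary.Decidable using (⌊_⌋)
open import Data.Bool using (Bool; true; false; if_then_else_)

-- Partitions into distinct parts, represented as strictly decreasing lists
-- of positive integers.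
-- distinctPartsBounded m n : all partitions of n into distinct parts,
-- each part in {1, ..., m}, listed exactly once each (as strictly decreasing lists).
distinctPartsBounded : ℕ → ℕ → List (List ℕ)
distinctPartsBounded zero zero = [] ∷ []
distinctPartsBounded zero (suc n) = []
distinctPartsBounded (suc m) n =
  distinctPartsBounded m n
  ++
  (if ⌊ suc m ≤? n ⌋
     then map (suc m ∷_) (distinctPartsBounded m (n ∸ suc m))
     else [])

D : ℕ → List (List ℕ)
D n = distinctPartsBounded n n

elem : ℕ → List ℕ → Bool
elem k xs = any (λ x → ⌊ k ≟ x ⌋) xs

mexFrom : ℕ → ℕ → List ℕ → ℕ
mexFrom zero start xs = start
mexFrom (suc fuel) start xs =
  if elem start xs then mexFrom fuel (suc start) xs else start

-- mex(π): least positive integer not a part of π.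
-- A list of length L misses some element of {1,...,L+1}, so fuel = sum π + 1 suffices
-- (parts are distinct positive, so length ≤ sum).
mex : List ℕ → ℕ
mex π = mexFrom (suc (sum π)) 1 π

σdmex : ℕ → ℕ
σdmex n = sum (map mex (D n))

-- Let S(m, n) be the sum of mex π over the partitions π of n into distinct parts ≤ m, so that
-- σ_d mex(n) = S(n, n) and S(m + 1, n) = S(m, n) + Δ(m, n), where Δ(m, n) runs over the partitions
-- with largest part m + 1. As S(0, n) = 0 for n > 0, it suffices to show Δ(m, n) ≤ Δ(m + 1, n + 1)
-- for every m, strictly for one m. Removing the largest part turns both increments into sums over
-- the partitions π of r = n − m − 1 with parts ≤ m: adjoining m + 2 leaves mex π unchanged, while
-- adjoining m + 1 raises it by one only for π = {1, …, m}, which requires r = 1 + ⋯ + m. In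
-- Δ(m + 1, n + 1) the partitions of r with largest part m + 1 contribute at least 1 each; this pays
-- for that one exception when n ≥ 4, and gives strictness whenever r ≠ 1 + ⋯ + m and such a
-- partition exists, which for n ≥ 7 happens at m ≈ n / 2.

module Submission where

open import Defs
open import Algebra.Properties.CommutativeSemigroup using (interchange)
open import Data.Bool using (true; false; if_then_else_; _∨_)
open import Data.Bool.Properties using (∨-zeroʳ)
open import Data.Empty using (⊥-elim)
open import Function using (_∘_)
open import Data.List using (List; []; _∷_; _++_; map; length)
open import Data.List.Properties using (map-++; map-∘; map-cong-local; length-map; length-++-≤ˡ; length-++-≤ʳ)
open import Data.List.Relation.Unary.All as All using (All; []; _∷_)
open import Data.List.Relation.Unary.All.Properties using (++⁺; map⁺)
open import Data.Nat using (ℕ; zero; suc; _+_; _∸_; _≤_; _<_; z≤n; s≤s; s≤s⁻¹; _≤?_; _≟_)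
open import Data.Nat.ListAction using (sum)
open import Data.Nat.ListAction.Properties using (sum-++)
open import Data.Nat.Properties
open import Data.Sum using (_⊎_; inj₁; inj₂)
open import Relation.Binary.PropositionalEquality
open import Relation.Nullary using (Dec; yes; no; ¬_)
open import Relation.Nullary.Decidable using (⌊_⌋; isYes≗does; dec-true; dec-false)

module _ {A : Set} where

  sum-map-++ : (f : A → ℕ) (xs ys : List A) →
               sum (map f (xs ++ ys)) ≡ sum (map f xs) + sum (map f ys)
  sum-map-++ f xs ys = trans (cong sum (map-++ f xs ys)) (sum-++ (map f xs) (map f ys))

  sum-map-+ : (f g : A → ℕ) (xs : List A) →
              sum (map (λ x → f x + g x) xs) ≡ sum (map f xs) + sum (map g xs)
  sum-map-+ f g [] = refl
  sum-map-+ f g (x ∷ xs) =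
    trans (cong (f x + g x +_) (sum-map-+ f g xs)) (interchange +-commutativeSemigroup (f x) (g x) _ _)

  sum-map-zero : {f : A → ℕ} {xs : List A} → All (λ x → f x ≡ 0) xs → sum (map f xs) ≡ 0
  sum-map-zero [] = refl
  sum-map-zero (fx≡0 ∷ rest) = cong₂ _+_ fx≡0 (sum-map-zero rest)

  length≤sum-map : {f : A → ℕ} → (∀ x → 1 ≤ f x) → (xs : List A) → length xs ≤ sum (map f xs)
  length≤sum-map f≥1 [] = z≤n
  length≤sum-map f≥1 (x ∷ xs) = +-mono-≤ (f≥1 x) (length≤sum-map f≥1 xs)

isYes-true : {P : Set} (p? : Dec P) → P → ⌊ p? ⌋ ≡ true
isYes-true p? p = trans (isYes≗does p?) (dec-true p? p)

isYes-false : {P : Set} (p? : Dec P) → ¬ P → ⌊ p? ⌋ ≡ false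
isYes-false p? ¬p = trans (isYes≗does p?) (dec-false p? ¬p)

𝟙[_] : {P : Set} → Dec P → ℕ
𝟙[ p? ] = if ⌊ p? ⌋ then 1 else 0

𝟙-yes : {P : Set} (p? : Dec P) → P → 𝟙[ p? ] ≡ 1
𝟙-yes p? p rewrite isYes-true p? p = refl

𝟙-no : {P : Set} (p? : Dec P) → ¬ P → 𝟙[ p? ] ≡ 0
𝟙-no p? ¬p rewrite isYes-false p? ¬p = refl

𝟙-mono : {P Q : Set} (p? : Dec P) (q? : Dec Q) → (P → Q) → 𝟙[ p? ] ≤ 𝟙[ q? ]
𝟙-mono (yes p) (yes q) P⇒Q = ≤-refl
𝟙-mono (yes p) (no ¬q) P⇒Q = ⊥-elim (¬q (P⇒Q p))
𝟙-mono (no ¬p) q? P⇒Q = z≤n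

triangle : ℕ → ℕ
triangle zero = 0
triangle (suc m) = suc m + triangle m

m≤triangle : ∀ m → m ≤ triangle m
m≤triangle zero = z≤n
m≤triangle (suc m) = m≤m+n (suc m) (triangle m)

<triangle : ∀ {m} → 2 ≤ m → m < triangle m
<triangle {suc (suc c)} (s≤s (s≤s _)) =
  ≤-trans (≤-reflexive (+-comm 1 (2 + c))) (+-monoʳ-≤ (2 + c) (s≤s z≤n))

3≤triangle : ∀ {m} → 2 ≤ m → 3 ≤ triangle m
3≤triangle 2≤m = ≤-trans (s≤s 2≤m) (<triangle 2≤m)

parts : ℕ → ℕ → List (List ℕ)
parts = distinctPartsBounded

partsWithMax : ℕ → ℕ → List (List ℕ)
partsWithMax m n = if ⌊ suc m ≤? n ⌋ then map (suc m ∷_) (parts m (n ∸ suc m)) else []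

partsWithMax-yes : ∀ {m n} → suc m ≤ n → partsWithMax m n ≡ map (suc m ∷_) (parts m (n ∸ suc m))
partsWithMax-yes {m} {n} m<n rewrite isYes-true (suc m ≤? n) m<n = refl

partsWithMax-no : ∀ {m n} → ¬ suc m ≤ n → partsWithMax m n ≡ []
partsWithMax-no {m} {n} m≮n rewrite isYes-false (suc m ≤? n) m≮n = refl

sum-map-partsWithMax : ∀ (f : List ℕ → ℕ) {m n} → suc m ≤ n →
  sum (map f (partsWithMax m n)) ≡ sum (map (λ π → f (suc m ∷ π)) (parts m (n ∸ suc m)))
sum-map-partsWithMax f {m} {n} m<n rewrite partsWithMax-yes m<n = cong sum (sym (map-∘ (parts m (n ∸ suc m))))

parts-bounded : ∀ m n → All (All (_≤ m)) (parts m n)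
parts-bounded zero zero = [] ∷ []
parts-bounded zero (suc n) = []
parts-bounded (suc m) n = ++⁺ (All.map weaken (parts-bounded m n)) (with-max (suc m ≤? n))
  where
  weaken : ∀ {π} → All (_≤ m) π → All (_≤ suc m) π
  weaken = All.map m≤n⇒m≤1+n
  with-max : Dec (suc m ≤ n) → All (All (_≤ suc m)) (partsWithMax m n)
  with-max (yes m<n) rewrite partsWithMax-yes m<n =
    map⁺ (All.map (λ π≤m → ≤-refl ∷ weaken π≤m) (parts-bounded m (n ∸ suc m)))
  with-max (no m≮n) rewrite partsWithMax-no m≮n = []

partsWithMax-nonempty : ∀ {m n} → suc m ≤ n → n ∸ suc m ≤ triangle m → 0 < length (partsWithMax m n)

parts-nonempty : ∀ {m n} → n ≤ triangle m → 0 < length (parts m n)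
parts-nonempty {zero} {zero} _ = s≤s z≤n
parts-nonempty {suc m} {n} n≤ with n ≤? triangle m
... | yes n≤' = ≤-trans (parts-nonempty {m} n≤') (length-++-≤ˡ (parts m n))
... | no n≰ = ≤-trans (partsWithMax-nonempty {m} m<n (m≤n+o⇒m∸n≤o n (suc m) n≤))
                      (length-++-≤ʳ (partsWithMax m n) {parts m n})
  where
  m<n : suc m ≤ n
  m<n = ≤-<-trans (m≤triangle m) (≰⇒> n≰)

partsWithMax-nonempty {m} {n} m<n r≤ =
  subst (0 <_) (sym (trans (cong length (partsWithMax-yes m<n)) (length-map (suc m ∷_) (parts m (n ∸ suc m)))))
        (parts-nonempty {m} r≤)

record IsMexFrom (s k : ℕ) (π : List ℕ) : Set where
  constructor isMexFrom
  field
    start≤ : s ≤ k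
    missing : elem k π ≡ false
    present : ∀ {j} → s ≤ j → j < k → elem j π ≡ true

open IsMexFrom

IsMex : ℕ → List ℕ → Set
IsMex = IsMexFrom 1

isMexFrom-≤-missing : ∀ {s k j π} → IsMexFrom s k π → s ≤ j → elem j π ≡ false → k ≤ j
isMexFrom-≤-missing {k = k} {j} mex s≤j j∉π with k ≤? j
... | yes k≤j = k≤j
... | no k≰j with () ← trans (sym (present mex s≤j (≰⇒> k≰j))) j∉π

isMexFrom-unique : ∀ {s k k′ π} → IsMexFrom s k π → IsMexFrom s k′ π → k ≡ k′
isMexFrom-unique mex mex′ =
  ≤-antisym (isMexFrom-≤-missing mex (start≤ mex′) (missing mex′))
            (isMexFrom-≤-missing mex′ (start≤ mex) (missing mex))

isMexFrom-extend : ∀ {s k π} → elem s π ≡ true → IsMexFrom (suc s) k π → IsMexFrom s k π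
isMexFrom-extend {s} {k} {π} s∈π mex = isMexFrom (≤-trans (n≤1+n s) (start≤ mex)) (missing mex) j∈
  where
  j∈ : ∀ {j} → s ≤ j → j < k → elem j π ≡ true
  j∈ s≤j j<k with m≤n⇒m<n∨m≡n s≤j
  ... | inj₁ s<j = present mex s<j j<k
  ... | inj₂ refl = s∈π

mexFrom-isMex : ∀ f s π → elem (s + f) π ≡ false → IsMexFrom s (mexFrom f s π) π
mexFrom-isMex zero s π s∉π =
  isMexFrom ≤-refl (subst (λ k → elem k π ≡ false) (+-identityʳ s) s∉π)
            (λ s≤j j<s → ⊥-elim (<⇒≱ j<s s≤j))
mexFrom-isMex (suc f) s π end∉π with elem s π in elem-s
... | true = isMexFrom-extend elem-s
               (mexFrom-isMex f (suc s) π (subst (λ k → elem k π ≡ false) (+-suc s f) end∉π))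
... | false = isMexFrom ≤-refl elem-s (λ s≤j j<s → ⊥-elim (<⇒≱ j<s s≤j))

elem-out-of-range : ∀ {m j} {π : List ℕ} → All (_≤ m) π → m < j → elem j π ≡ false
elem-out-of-range [] m<j = refl
elem-out-of-range {j = j} {x ∷ π} (x≤m ∷ π≤m) m<j
  rewrite isYes-false (j ≟ x) (λ { refl → <⇒≱ m<j x≤m }) = elem-out-of-range π≤m m<j

isMexFrom-∷-other : ∀ {s k x π} → IsMexFrom s k π → x ≢ k → IsMexFrom s k (x ∷ π)
isMexFrom-∷-other {s} {k} {x} {π} mex x≢k = isMexFrom (start≤ mex) k∉ j∈
  where
  k∉ : ⌊ k ≟ x ⌋ ∨ elem k π ≡ false
  k∉ rewrite isYes-false (k ≟ x) (≢-sym x≢k) = missing mex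
  j∈ : ∀ {j} → s ≤ j → j < k → ⌊ j ≟ x ⌋ ∨ elem j π ≡ true
  j∈ s≤j j<k rewrite present mex s≤j j<k = ∨-zeroʳ _

isMexFrom-∷-self : ∀ {s k π} → IsMexFrom s k π → elem (suc k) π ≡ false → IsMexFrom s (suc k) (k ∷ π)
isMexFrom-∷-self {s} {k} {π} mex k+1∉π = isMexFrom (m≤n⇒m≤1+n (start≤ mex)) k+1∉ j∈
  where
  k+1∉ : ⌊ suc k ≟ k ⌋ ∨ elem (suc k) π ≡ false
  k+1∉ rewrite isYes-false (suc k ≟ k) 1+n≢n = k+1∉π
  j∈ : ∀ {j} → s ≤ j → j < suc k → ⌊ j ≟ k ⌋ ∨ elem j π ≡ true
  j∈ {j} s≤j j≤k with j ≟ k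
  ... | yes _ = refl
  ... | no j≢k = present mex s≤j (≤∧≢⇒< (s≤s⁻¹ j≤k) j≢k)

All≤sum : (π : List ℕ) → All (_≤ sum π) π
All≤sum [] = []
All≤sum (x ∷ π) = m≤m+n x (sum π) ∷ All.map (λ y≤ → ≤-trans y≤ (m≤n+m (sum π) x)) (All≤sum π)

mex-isMex : ∀ π → IsMex (mex π) π
mex-isMex π = mexFrom-isMex (suc (sum π)) 1 π (elem-out-of-range (All≤sum π) (m<n⇒m<1+n (n<1+n (sum π))))

mex-unique : ∀ {k π} → IsMex k π → mex π ≡ k
mex-unique {π = π} = isMexFrom-unique (mex-isMex π)

1≤mex : ∀ π → 1 ≤ mex π
1≤mex π = start≤ (mex-isMex π)

mex≤ : ∀ {m π} → All (_≤ m) π → mex π ≤ suc m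
mex≤ {m} {π} π≤m = isMexFrom-≤-missing (mex-isMex π) (s≤s z≤n) (elem-out-of-range π≤m (n<1+n m))

mex-∷-above : ∀ {m π} → All (_≤ m) π → mex (suc (suc m) ∷ π) ≡ mex π
mex-∷-above {m} {π} π≤m =
  mex-unique (isMexFrom-∷-other (mex-isMex π) (λ e → 1+n≰n (subst (_≤ suc m) (sym e) (mex≤ π≤m))))

mex-∷-covered : ∀ {m π} → All (_≤ m) π → mex π ≡ suc m → mex (suc m ∷ π) ≡ suc (suc m)
mex-∷-covered {m} {π} π≤m e =
  mex-unique (isMexFrom-∷-self (subst (λ k → IsMex k π) e (mex-isMex π))
                               (elem-out-of-range π≤m (n≤1+n (suc m))))

mex-∷-uncovered : ∀ {m π} → mex π ≢ suc m → mex (suc m ∷ π) ≡ mex π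
mex-∷-uncovered {π = π} ne = mex-unique (isMexFrom-∷-other (mex-isMex π) (ne ∘ sym))

-- For π with parts ≤ m, covers m π = 1 only for π = {1, …, m}, a partition of triangle m.
covers : ℕ → List ℕ → ℕ
covers m π = 𝟙[ mex π ≟ suc m ]

mex-∷-next : ∀ {m π} → All (_≤ m) π → mex (suc m ∷ π) ≡ mex π + covers m π
mex-∷-next {m} {π} π≤m = by-cases (mex π ≟ suc m)
  where
  open ≡-Reasoning
  by-cases : Dec (mex π ≡ suc m) → mex (suc m ∷ π) ≡ mex π + covers m π
  by-cases (yes e) = begin
    mex (suc m ∷ π)     ≡⟨ mex-∷-covered π≤m e ⟩
    suc (suc m)         ≡⟨ cong suc (sym e) ⟩
    suc (mex π)         ≡⟨ +-comm 1 (mex π) ⟩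
    mex π + 1           ≡⟨ cong (mex π +_) (𝟙-yes (mex π ≟ suc m) e) ⟨
    mex π + covers m π  ∎
  by-cases (no ne) = begin
    mex (suc m ∷ π)     ≡⟨ mex-∷-uncovered ne ⟩
    mex π               ≡⟨ +-identityʳ (mex π) ⟨
    mex π + 0           ≡⟨ cong (mex π +_) (𝟙-no (mex π ≟ suc m) ne) ⟨
    mex π + covers m π  ∎

covers-suc≡0 : ∀ {m π} → All (_≤ m) π → covers (suc m) π ≡ 0
covers-suc≡0 {m} {π} π≤m =
  𝟙-no (mex π ≟ suc (suc m)) (λ e → 1+n≰n (subst (_≤ suc m) e (mex≤ π≤m)))

covers-∷ : ∀ {m π} → All (_≤ m) π → covers (suc m) (suc m ∷ π) ≡ covers m π
covers-∷ {m} {π} π≤m = by-cases (mex π ≟ suc m)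
  where
  by-cases : Dec (mex π ≡ suc m) → covers (suc m) (suc m ∷ π) ≡ covers m π
  by-cases (yes e) = trans (𝟙-yes (mex (suc m ∷ π) ≟ suc (suc m)) (mex-∷-covered π≤m e))
                           (sym (𝟙-yes (mex π ≟ suc m) e))
  by-cases (no ne) = trans (𝟙-no (mex (suc m ∷ π) ≟ suc (suc m)) (λ e → 1+n≰n (subst (_≤ suc m) e mex∷≤)))
                           (sym (𝟙-no (mex π ≟ suc m) ne))
    where
    mex∷≤ : mex (suc m ∷ π) ≤ suc m
    mex∷≤ = ≤-trans (≤-reflexive (mex-∷-uncovered ne)) (mex≤ π≤m)

sum-covers≤ : ∀ m n → sum (map (covers m) (parts m n)) ≤ 𝟙[ n ≟ triangle m ]
sum-covers≤ zero zero = ≤-refl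
sum-covers≤ zero (suc n) = z≤n
sum-covers≤ (suc m) n = begin
  sum (map (covers (suc m)) (parts m n ++ partsWithMax m n))
    ≡⟨ sum-map-++ (covers (suc m)) (parts m n) (partsWithMax m n) ⟩
  sum (map (covers (suc m)) (parts m n)) + sum (map (covers (suc m)) (partsWithMax m n))
    ≡⟨ cong (_+ sum (map (covers (suc m)) (partsWithMax m n)))
            (sum-map-zero (All.map covers-suc≡0 (parts-bounded m n))) ⟩
  sum (map (covers (suc m)) (partsWithMax m n))
    ≤⟨ with-max (suc m ≤? n) ⟩
  𝟙[ n ≟ triangle (suc m) ] ∎
  where
  open ≤-Reasoning
  with-max : Dec (suc m ≤ n) → sum (map (covers (suc m)) (partsWithMax m n)) ≤ 𝟙[ n ≟ triangle (suc m) ]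
  with-max (no m≮n) rewrite partsWithMax-no m≮n = z≤n
  with-max (yes m<n) = begin
    sum (map (covers (suc m)) (partsWithMax m n))
      ≡⟨ sum-map-partsWithMax (covers (suc m)) m<n ⟩
    sum (map (λ π → covers (suc m) (suc m ∷ π)) (parts m r))
      ≡⟨ cong sum (map-cong-local (All.map covers-∷ (parts-bounded m r))) ⟩
    sum (map (covers m) (parts m r))
      ≤⟨ sum-covers≤ m r ⟩
    𝟙[ r ≟ triangle m ]
      ≤⟨ 𝟙-mono (r ≟ triangle m) (n ≟ triangle (suc m))
                (λ e → trans (sym (m+[n∸m]≡n m<n)) (cong (suc m +_) e)) ⟩
    𝟙[ n ≟ triangle (suc m) ] ∎
    where r = n ∸ suc m

mexSum : ℕ → ℕ → ℕ
mexSum m n = sum (map mex (parts m n))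

mexSumWith : ℕ → ℕ → ℕ → ℕ
mexSumWith x m n = sum (map (λ π → mex (x ∷ π)) (parts m n))

mexSumWith-next≤ : ∀ a r → mexSumWith (suc a) a r ≤ mexSum a r + 𝟙[ r ≟ triangle a ]
mexSumWith-next≤ a r = begin
  mexSumWith (suc a) a r
    ≡⟨ cong sum (map-cong-local (All.map mex-∷-next (parts-bounded a r))) ⟩
  sum (map (λ π → mex π + covers a π) (parts a r))
    ≡⟨ sum-map-+ mex (covers a) (parts a r) ⟩
  mexSum a r + sum (map (covers a) (parts a r))
    ≤⟨ +-monoʳ-≤ (mexSum a r) (sum-covers≤ a r) ⟩
  mexSum a r + 𝟙[ r ≟ triangle a ] ∎
  where open ≤-Reasoning

mexSum+length≤mexSumWith : ∀ a r → mexSum a r + length (partsWithMax a r) ≤ mexSumWith (suc (suc a)) (suc a) r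
mexSum+length≤mexSumWith a r = begin
  mexSum a r + length (partsWithMax a r)
    ≤⟨ +-mono-≤ (≤-reflexive (cong sum (map-cong-local (All.map (sym ∘ mex-∷-above) (parts-bounded a r)))))
                (length≤sum-map (λ π → 1≤mex (suc (suc a) ∷ π)) (partsWithMax a r)) ⟩
  sum (map f (parts a r)) + sum (map f (partsWithMax a r))
    ≡⟨ sum-map-++ f (parts a r) (partsWithMax a r) ⟨
  mexSumWith (suc (suc a)) (suc a) r ∎
  where
  open ≤-Reasoning
  f : List ℕ → ℕ
  f π = mex (suc (suc a) ∷ π)

𝟙-triangle≤length-partsWithMax : ∀ {a r} → 2 ≤ a ⊎ 2 ≤ r →
                                 𝟙[ r ≟ triangle a ] ≤ length (partsWithMax a r)
𝟙-triangle≤length-partsWithMax {a} {r} big with r ≟ triangle a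
... | no _ = z≤n
𝟙-triangle≤length-partsWithMax {suc (suc c)} _ | yes refl =
  partsWithMax-nonempty (<triangle (s≤s (s≤s z≤n))) (m∸n≤m (triangle (2 + c)) (3 + c))
𝟙-triangle≤length-partsWithMax {zero} (inj₂ ()) | yes refl
𝟙-triangle≤length-partsWithMax {suc zero} (inj₁ (s≤s ())) | yes refl
𝟙-triangle≤length-partsWithMax {suc zero} (inj₂ (s≤s ())) | yes refl

mexSumWith-mono : ∀ a r → 2 ≤ a ⊎ 2 ≤ r → mexSumWith (suc a) a r ≤ mexSumWith (suc (suc a)) (suc a) r
mexSumWith-mono a r big = begin
  mexSumWith (suc a) a r                   ≤⟨ mexSumWith-next≤ a r ⟩
  mexSum a r + 𝟙[ r ≟ triangle a ]        ≤⟨ +-monoʳ-≤ (mexSum a r) (𝟙-triangle≤length-partsWithMax big) ⟩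
  mexSum a r + length (partsWithMax a r)   ≤⟨ mexSum+length≤mexSumWith a r ⟩
  mexSumWith (suc (suc a)) (suc a) r       ∎
  where open ≤-Reasoning

mexSumWith-strict : ∀ a r → r ≢ triangle a → 0 < length (partsWithMax a r) →
                    mexSumWith (suc a) a r < mexSumWith (suc (suc a)) (suc a) r
mexSumWith-strict a r r≢ nonempty = begin-strict
  mexSumWith (suc a) a r                   ≤⟨ mexSumWith-next≤ a r ⟩
  mexSum a r + 𝟙[ r ≟ triangle a ]        ≡⟨ cong (mexSum a r +_) (𝟙-no (r ≟ triangle a) r≢) ⟩
  mexSum a r + 0                           <⟨ +-monoʳ-< (mexSum a r) nonempty ⟩
  mexSum a r + length (partsWithMax a r)   ≤⟨ mexSum+length≤mexSumWith a r ⟩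
  mexSumWith (suc (suc a)) (suc a) r       ∎
  where open ≤-Reasoning

Δ : ℕ → ℕ → ℕ
Δ m n = sum (map mex (partsWithMax m n))

mexSum-suc : ∀ m n → mexSum (suc m) n ≡ mexSum m n + Δ m n
mexSum-suc m n = sum-map-++ mex (parts m n) (partsWithMax m n)

Δ-mono : ∀ {n} → 4 ≤ n → ∀ m → Δ m n ≤ Δ (suc m) (suc n)
Δ-mono {n} 4≤n m = by-cases (suc m ≤? n)
  where
  open ≤-Reasoning
  big : ∀ k → 2 ≤ k ⊎ 2 ≤ n ∸ suc k
  big zero = inj₂ (∸-monoˡ-≤ 1 (≤-trans (n≤1+n 3) 4≤n))
  big (suc zero) = inj₂ (∸-monoˡ-≤ 2 4≤n)
  big (suc (suc _)) = inj₁ (s≤s (s≤s z≤n))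
  by-cases : Dec (suc m ≤ n) → Δ m n ≤ Δ (suc m) (suc n)
  by-cases (no m≮n) rewrite partsWithMax-no m≮n = z≤n
  by-cases (yes m<n) = begin
    Δ m n                                          ≡⟨ sum-map-partsWithMax mex m<n ⟩
    mexSumWith (suc m) m (n ∸ suc m)               ≤⟨ mexSumWith-mono m (n ∸ suc m) (big m) ⟩
    mexSumWith (suc (suc m)) (suc m) (n ∸ suc m)   ≡⟨ sum-map-partsWithMax mex (s≤s m<n) ⟨
    Δ (suc m) (suc n)                              ∎

Δ-+ : ∀ a r → Δ a (suc a + r) ≡ mexSumWith (suc a) a r
Δ-+ a r = trans (sum-map-partsWithMax mex (m≤m+n (suc a) r)) (cong (mexSumWith (suc a) a) (m+n∸m≡n (suc a) r))

Δ-strict : ∀ a r → r ≢ triangle a → 0 < length (partsWithMax a r) →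
           Δ a (suc a + r) < Δ (suc a) (suc (suc a + r))
Δ-strict a r r≢ nonempty = begin-strict
  Δ a (suc a + r)                     ≡⟨ Δ-+ a r ⟩
  mexSumWith (suc a) a r              <⟨ mexSumWith-strict a r r≢ nonempty ⟩
  mexSumWith (suc (suc a)) (suc a) r  ≡⟨ Δ-+ (suc a) r ⟨
  Δ (suc a) (suc (suc a + r))         ∎
  where open ≤-Reasoning

module _ {f g u v : ℕ → ℕ}
         (f-suc : ∀ m → f (suc m) ≡ f m + u m) (g-suc : ∀ m → g (suc m) ≡ g m + v m)
         (u≤v : ∀ m → u m ≤ v m) (f0≤g0 : f 0 ≤ g 0) where

  open ≤-Reasoning

  ≤-by-increments : ∀ m → f m ≤ g m
  ≤-by-increments zero = f0≤g0
  ≤-by-increments (suc m) = begin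
    f (suc m)  ≡⟨ f-suc m ⟩
    f m + u m  ≤⟨ +-mono-≤ (≤-by-increments m) (u≤v m) ⟩
    g m + v m  ≡⟨ g-suc m ⟨
    g (suc m)  ∎

  <-by-increments : ∀ {k} → u k < v k → ∀ j → f (suc (j + k)) < g (suc (j + k))
  <-by-increments {k} uk<vk zero = begin-strict
    f (suc k)  ≡⟨ f-suc k ⟩
    f k + u k  <⟨ +-mono-≤-< (≤-by-increments k) uk<vk ⟩
    g k + v k  ≡⟨ g-suc k ⟨
    g (suc k)  ∎
  <-by-increments {k} uk<vk (suc j) = begin-strict
    f (suc (suc j + k))             ≡⟨ f-suc (suc (j + k)) ⟩
    f (suc (j + k)) + u (suc j + k) <⟨ +-mono-<-≤ (<-by-increments uk<vk j) (u≤v (suc j + k)) ⟩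
    g (suc (j + k)) + v (suc j + k) ≡⟨ g-suc (suc (j + k)) ⟨
    g (suc (suc j + k))             ∎

σdmex-<-split : ∀ N a r → N ≡ suc a + r → 4 ≤ N → r ≢ triangle a → 0 < length (partsWithMax a r) →
                σdmex N < σdmex (suc N)
σdmex-<-split .(suc a + r) a r refl 4≤N r≢ nonempty =
  subst (λ i → mexSum i N < mexSum (suc i) (suc N)) (cong suc (+-comm r a))
        (<-by-increments (λ m → mexSum-suc m N) (λ m → mexSum-suc (suc m) (suc N)) (Δ-mono 4≤N) z≤n
                         (Δ-strict a r r≢ nonempty) r)
  where N = suc a + r

record StrictSplit (N : ℕ) : Set where
  field
    a s : ℕ
    N≡ : N ≡ suc a + (suc a + s)
    2≤a : 2 ≤ a
    s≤1 : s ≤ 1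
    1+a+s≢triangle : suc a + s ≢ triangle a

strictSplit : ∀ k → StrictSplit (7 + k)
strictSplit zero =
  record { a = 2 ; s = 1 ; N≡ = refl ; 2≤a = ≤-refl ; s≤1 = ≤-refl ; 1+a+s≢triangle = λ () }
strictSplit (suc zero) =
  record { a = 3 ; s = 0 ; N≡ = refl ; 2≤a = n≤1+n 2 ; s≤1 = z≤n ; 1+a+s≢triangle = λ () }
strictSplit (suc (suc k)) = record
  { a = suc a
  ; s = s
  ; N≡ = trans (cong (2 +_) N≡) (cong (suc ∘ suc) (sym (+-suc a (suc a + s))))
  ; 2≤a = m≤n⇒m≤1+n 2≤a
  ; s≤1 = s≤1
  ; 1+a+s≢triangle = λ e → <⇒≢ (≤-<-trans (s≤s s≤1) (3≤triangle 2≤a))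
                             (+-cancelˡ-≡ (suc a) _ _ (trans (+-suc (suc a) s) e))
  }
  where open StrictSplit (strictSplit k)

σdmex-<-from-7 : ∀ k → σdmex (7 + k) < σdmex (8 + k)
σdmex-<-from-7 k = σdmex-<-split (7 + k) a (suc a + s) N≡ (s≤s (s≤s (s≤s (s≤s z≤n)))) 1+a+s≢triangle
  (partsWithMax-nonempty (m≤m+n (suc a) s) (subst (_≤ triangle a) (sym (m+n∸m≡n (suc a) s)) s≤triangle))
  where
  open StrictSplit (strictSplit k)
  s≤triangle : s ≤ triangle a
  s≤triangle = ≤-trans s≤1 (≤-trans (s≤s z≤n) (3≤triangle 2≤a))

proposition3p1 : (n : ℕ) → 7 ≤ n → σdmex n < σdmex (suc n)
proposition3p1 n 7≤n = subst (λ m → σdmex m < σdmex (suc m)) (m+[n∸m]≡n 7≤n) (σdmex-<-from-7 (n ∸ 7))
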